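{- If a graph $G$ has maximum degree $\Delta$, then $\chi_{\text{lid}}(G)\leq \Delta^3-\Delta^2+\Delta+1$.
   Context: All graphs are finite and simple. For a vertex $u$, $N[u]$ is its closed neighborhood; for a coloring $c$ and vertex set $S$, $c(S)$ is the set of colors on $S$. A lid-coloring of $G$ is a proper vertex-coloring $c$ such that for every edge $uv$ with $N[u]\neq N[v]$, $c(N[u])\neq c(N[v])$; $\chi_{\text{lid}}(G)$ is the minimum number of colors in a lid-coloring of $G$. -}

module Defs where

open import Data.Nat using (ℕ; _≤_; _+_; _*_; _∸_; _^_)
open import Data.Fin using (Fin)
open import Data.Bool using (Bool; true; false; T)
open import Data.List using (List; length; filter; allFin)
open import Data.Product using (Σ; ∃; _×_; _,_)
open import Data.Sum using (_⊎_)
open import Relation.Binary.PropositionalEquality using (_≡_; _≢_)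
open import Relation.Nullary using (¬_)
open import Relation.Nullary.Decidable using (does)
open import Data.Bool.Properties using (T?)
open import Function.Bundles using (_⇔_)

record Graph (n : ℕ) : Set where
  field
    adj     : Fin n → Fin n → Bool
    symm    : ∀ u v → adj u v ≡ adj v u
    irrefl  : ∀ u → adj u u ≡ false

open Graph public

Adjacent : ∀ {n} → Graph n → Fin n → Fin n → Set
Adjacent G u v = T (adj G u v)

degree : ∀ {n} → Graph n → Fin n → ℕ
degree {n} G u = length (filter (λ v → T? (adj G u v)) (allFin n))

-- G has maximum degree Δ (for the empty graph, any Δ is accepted; the
-- bound is then trivial)
HasMaxDegree : ∀ {n} → Graph n → ℕ → Set
HasMaxDegree {n} G Δ =
  (∀ u → degree G u ≤ Δ) × (n ≡ 0 ⊎ ∃ λ u → degree G u ≡ Δ)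

InClosedNbhd : ∀ {n} → Graph n → Fin n → Fin n → Set
InClosedNbhd G u w = u ≡ w ⊎ Adjacent G u w

SameClosedNbhd : ∀ {n} → Graph n → Fin n → Fin n → Set
SameClosedNbhd {n} G u v = ∀ (w : Fin n) → InClosedNbhd G u w ⇔ InClosedNbhd G v w

ColorInNbhd : ∀ {n k} → Graph n → (Fin n → Fin k) → Fin n → Fin k → Set
ColorInNbhd G c u x = ∃ λ w → InClosedNbhd G u w × c w ≡ x

SameNbhdColors : ∀ {n k} → Graph n → (Fin n → Fin k) → Fin n → Fin n → Set
SameNbhdColors {k = k} G c u v =
  ∀ (x : Fin k) → ColorInNbhd G c u x ⇔ ColorInNbhd G c v x

IsProper : ∀ {n k} → Graph n → (Fin n → Fin k) → Set
IsProper G c = ∀ u v → Adjacent G u v → c u ≢ c v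

IsLidColoring : ∀ {n k} → Graph n → (Fin n → Fin k) → Set
IsLidColoring G c =
  IsProper G c ×
  (∀ u v → Adjacent G u v → ¬ SameClosedNbhd G u v → ¬ SameNbhdColors G c u v)

LidColorable : ∀ {n} → Graph n → ℕ → Set
LidColorable {n} G k = Σ (Fin n → Fin k) λ c → IsLidColoring G c

-- Call two vertices 3-close if they are joined by a walk of length three in
-- closed neighbourhoods, i.e. if their distance is at most 3.  The proof has
-- three independent ingredients.
--   * Greedy colouring (general): if a symmetric conflict relation on Fin n
--     admits, for every vertex, a list of fewer than k vertices covering all
--     of its conflicts, then colouring the vertices 0, 1, …, n − 1 in turn with
--     a colour unused on earlier conflicts gives a k-colouring in which
--     conflicting vertices get distinct colours.
--   * Counting: the endpoints of non-backtracking walks of length one, two and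
--     three from u cover every vertex 3-close to u, and there are at most
--     Δ + Δ(Δ − 1) + Δ(Δ − 1)² = Δ³ − Δ² + Δ of them.
--   * Any colouring separating 3-close vertices is a lid-colouring: it is
--     proper, and if u ~ v with c(N[u]) = c(N[v]), then every w ∈ N[u] has a
--     colour-twin x ∈ N[v]; as w, u, v, x is a walk, w = x, so N[u] = N[v].
-- The main theorem applies greedy colouring to 3-closeness.
module Submission where

open import Defs
open import Data.Nat using (ℕ; zero; suc; _+_; _*_; _∸_; _≤_; _<_; z≤n; s≤s; s≤s⁻¹; _<?_)
open import Data.Nat.Properties
  using (≤-trans; ≤-refl; ≤-<-trans; <⇒≤; ≤∧≢⇒<; +-mono-≤; *-mono-≤;
         +-assoc; m+n∸m≡n; m<m+n; module ≤-Reasoning)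
open import Data.Nat.Tactic.RingSolver using (solve-∀)
open import Data.Fin using (Fin; toℕ; fromℕ<; _≟_)
open import Data.Fin.Properties using (pigeonhole; ¬∀⟶∃¬; toℕ-fromℕ<; toℕ-injective; toℕ<n; <⇒≢)
open import Data.Vec.Functional using (updateAt)
open import Data.Vec.Functional.Properties using (updateAt-updates; updateAt-minimal)
open import Data.Bool using (T)
open import Data.Bool.Properties using (T?)
open import Data.List using (List; []; _∷_; length; filter; allFin; map; concatMap; _++_; lookup)
open import Data.List.Properties using (length-++; length-map; length-filter; filter-notAll)
open import Data.List.Membership.Propositional using (_∈_; _∉_; lose)
open import Data.List.Membership.Propositional.Properties
  using (∈-filter⁺; ∈-filter⁻; ∈-allFin; ∈-++⁺ˡ; ∈-++⁺ʳ; ∈-map⁺; ∈-concatMap⁺)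
import Data.List.Membership.DecPropositional as DecMembership
open import Data.List.Relation.Unary.Any as Any using (here; there)
open import Data.List.Relation.Unary.Any.Properties using (lookup-index)
open import Data.Product using (Σ; ∃; _×_; _,_; proj₁; proj₂)
open import Data.Sum using (inj₁; inj₂)
open import Data.Empty using (⊥-elim)
open import Function using (const)
open import Function.Bundles using (mk⇔; Equivalence)
open import Function.Properties.Equivalence using () renaming (sym to ⇔-sym)
open import Relation.Binary.PropositionalEquality
  using (_≡_; _≢_; refl; sym; trans; cong; subst; module ≡-Reasoning)
open import Relation.Nullary using (¬_; yes; no; ¬?)

-- A list of fewer than k colours misses some colour of Fin k (pigeonhole on
-- the positions at which the colours would occur).
freeColour : ∀ {k} (xs : List (Fin k)) → length xs < k → ∃ λ x → x ∉ xs
freeColour {k} xs short = ¬∀⟶∃¬ k (_∈ xs) (_∈? xs) notAllListed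
  where
  open DecMembership (_≟_ {k}) using (_∈?_)
  notAllListed : ¬ (∀ x → x ∈ xs)
  notAllListed listed with pigeonhole short (λ x → Any.index (listed x))
  ... | i , j , i<j , sameIndex = <⇒≢ i<j (begin
    i                                ≡⟨ lookup-index (listed i) ⟩
    lookup xs (Any.index (listed i)) ≡⟨ cong (lookup xs) sameIndex ⟩
    lookup xs (Any.index (listed j)) ≡⟨ lookup-index (listed j) ⟨
    j                                ∎)
    where open ≡-Reasoning

length-concatMap-≤ : ∀ {A B : Set} (f : A → List B) (xs : List A) (b : ℕ) →
  (∀ x → x ∈ xs → length (f x) ≤ b) → length (concatMap f xs) ≤ length xs * b
length-concatMap-≤ f [] b bounded = z≤n
length-concatMap-≤ f (x ∷ xs) b bounded =
  subst (_≤ b + length xs * b) (sym (length-++ (f x)))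
    (+-mono-≤ (bounded x (here refl))
              (length-concatMap-≤ f xs b (λ y y∈xs → bounded y (there y∈xs))))

module GreedyColouring {n k : ℕ} (R : Fin n → Fin n → Set)
  (R-sym : ∀ {i j} → R i j → R j i)
  (conflicts : Fin n → List (Fin n))
  (conflicts-complete : ∀ {i j} → i ≢ j → R i j → j ∈ conflicts i)
  (conflicts-short : ∀ i → length (conflicts i) < k) where

  SeparatesBelow : ℕ → (Fin n → Fin k) → Set
  SeparatesBelow m c =
    ∀ {i j} → toℕ i < m → toℕ j < m → i ≢ j → R i j → c i ≢ c j

  extend : ∀ {m} → m < n → (c : Fin n → Fin k) → SeparatesBelow m c →
           Σ (Fin n → Fin k) (SeparatesBelow (suc m))
  extend {m} m<n c separates = c′ , separates′
    where
    v : Fin n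
    v = fromℕ< m<n

    earlierConflicts : List (Fin n)
    earlierConflicts = filter (λ j → toℕ j <? m) (conflicts v)

    usedColours : List (Fin k)
    usedColours = map c earlierConflicts

    fewUsed : length usedColours < k
    fewUsed = ≤-<-trans (begin
      length usedColours       ≡⟨ length-map c earlierConflicts ⟩
      length earlierConflicts  ≤⟨ length-filter (λ j → toℕ j <? m) (conflicts v) ⟩
      length (conflicts v)     ∎) (conflicts-short v)
      where open ≤-Reasoning

    fresh : Fin k
    fresh = proj₁ (freeColour usedColours fewUsed)

    c′ : Fin n → Fin k
    c′ = updateAt c v (const fresh)

    fresh-avoids : ∀ {j} → toℕ j < m → v ≢ j → R v j → fresh ≢ c j
    fresh-avoids {j} j<m v≢j conflict same =
      proj₂ (freeColour usedColours fewUsed)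
        (subst (_∈ usedColours) (sym same)
          (∈-map⁺ c (∈-filter⁺ (λ j → toℕ j <? m) (conflicts-complete v≢j conflict) j<m)))

    below : ∀ {i} → toℕ i < suc m → i ≢ v → toℕ i < m
    below {i} i<1+m i≢v = ≤∧≢⇒< (s≤s⁻¹ i<1+m)
      (λ i≡m → i≢v (toℕ-injective (trans i≡m (sym (toℕ-fromℕ< m<n)))))

    separates′ : SeparatesBelow (suc m) c′
    separates′ {i} {j} i<1+m j<1+m i≢j conflict with i ≟ v | j ≟ v
    ... | yes refl | yes refl = ⊥-elim (i≢j refl)
    ... | yes refl | no j≢v = λ same → fresh-avoids (below j<1+m j≢v) i≢j conflict
          (trans (sym (updateAt-updates v c)) (trans same (updateAt-minimal j v c j≢v)))
    ... | no i≢v | yes refl = λ same → fresh-avoids (below i<1+m i≢v) (λ e → i≢j (sym e))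
          (R-sym conflict)
          (trans (sym (updateAt-updates v c)) (trans (sym same) (updateAt-minimal i v c i≢v)))
    ... | no i≢v | no j≢v =
          subst₂≢ (updateAt-minimal i v c i≢v) (updateAt-minimal j v c j≢v)
            (separates (below i<1+m i≢v) (below j<1+m j≢v) i≢j conflict)
      where
      subst₂≢ : ∀ {a a′ b b′ : Fin k} → a′ ≡ a → b′ ≡ b → a ≢ b → a′ ≢ b′
      subst₂≢ refl refl a≢b = a≢b

  colourBelow : ∀ m → m ≤ n → Σ (Fin n → Fin k) (SeparatesBelow m)
  colourBelow zero _ = (λ i → fromℕ< (≤-<-trans z≤n (conflicts-short i))) , λ ()
  colourBelow (suc m) m<n with colourBelow m (<⇒≤ m<n)
  ... | c , separates = extend m<n c separates

  colouring : Σ (Fin n → Fin k) λ c → ∀ {i j} → i ≢ j → R i j → c i ≢ c j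
  colouring with colourBelow n ≤-refl
  ... | c , separates = c , separates (toℕ<n _) (toℕ<n _)

module Closeness {n : ℕ} (G : Graph n) where

  adjacent-sym : ∀ {a b} → Adjacent G a b → Adjacent G b a
  adjacent-sym {a} {b} = subst T (symm G a b)

  ¬adjacent-self : ∀ {a} → ¬ Adjacent G a a
  ¬adjacent-self {a} = subst T (irrefl G a)

  closed-sym : ∀ {a b} → InClosedNbhd G a b → InClosedNbhd G b a
  closed-sym (inj₁ refl) = inj₁ refl
  closed-sym (inj₂ a~b)  = inj₂ (adjacent-sym a~b)

  Close3 : Fin n → Fin n → Set
  Close3 a b = ∃ λ x → ∃ λ y →
    InClosedNbhd G a x × InClosedNbhd G x y × InClosedNbhd G y b

  close3-sym : ∀ {a b} → Close3 a b → Close3 b a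
  close3-sym (x , y , ax , xy , yb) = y , x , closed-sym yb , closed-sym xy , closed-sym ax

  separates-close3⇒lid : ∀ {k} (c : Fin n → Fin k) →
    (∀ {i j} → i ≢ j → Close3 i j → c i ≢ c j) → IsLidColoring G c
  separates-close3⇒lid c separates = proper , distinguishes
    where
    proper : IsProper G c
    proper u v u~v = separates (λ { refl → ¬adjacent-self u~v })
                               (v , v , inj₂ u~v , inj₁ refl , inj₁ refl)

    -- if u ~ v and c(N[u]) ⊆ c(N[v]) then N[u] ⊆ N[v]: a colour-twin in N[v]
    -- of w ∈ N[u] is 3-close to w, hence is w itself
    nbhdIncluded : ∀ u v → Adjacent G u v → SameNbhdColors G c u v →
                   ∀ w → InClosedNbhd G u w → InClosedNbhd G v w
    nbhdIncluded u v u~v sameColours w u∋w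
      with Equivalence.to (sameColours (c w)) (w , u∋w , refl)
    ... | x , v∋x , cx≡cw with w ≟ x
    ... | yes refl = v∋x
    ... | no w≢x = ⊥-elim (separates w≢x (u , v , closed-sym u∋w , inj₂ u~v , v∋x) (sym cx≡cw))

    distinguishes : ∀ u v → Adjacent G u v → ¬ SameClosedNbhd G u v →
                    ¬ SameNbhdColors G c u v
    distinguishes u v u~v differentNbhds sameColours = differentNbhds λ w → mk⇔
      (nbhdIncluded u v u~v sameColours w)
      (nbhdIncluded v u (adjacent-sym u~v) (λ x → ⇔-sym (sameColours x)) w)

module BoundedDegree {n} (G : Graph n) (Δ : ℕ) (degree≤Δ : ∀ u → degree G u ≤ Δ) where
  open Closeness G

  neighbours : Fin n → List (Fin n)
  neighbours u = filter (λ v → T? (adj G u v)) (allFin n)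

  ∈-neighbours⁺ : ∀ {a b} → Adjacent G a b → b ∈ neighbours a
  ∈-neighbours⁺ {a} {b} = ∈-filter⁺ (λ v → T? (adj G a v)) (∈-allFin b)

  ∈-neighbours⁻ : ∀ {a b} → b ∈ neighbours a → Adjacent G a b
  ∈-neighbours⁻ {a} b∈ = proj₂ (∈-filter⁻ (λ v → T? (adj G a v)) {xs = allFin n} b∈)

  -- the next steps of a walk at x that do not go back to the previous vertex p
  forward : Fin n → Fin n → List (Fin n)
  forward p x = filter (λ w → ¬? (w ≟ p)) (neighbours x)

  ∈-forward⁺ : ∀ {p x w} → Adjacent G x w → w ≢ p → w ∈ forward p x
  ∈-forward⁺ {p} x~w = ∈-filter⁺ (λ w → ¬? (w ≟ p)) (∈-neighbours⁺ x~w)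

  ∈-forward⁻ : ∀ {p x w} → w ∈ forward p x → Adjacent G x w
  ∈-forward⁻ {p} {x} w∈ =
    ∈-neighbours⁻ (proj₁ (∈-filter⁻ (λ w → ¬? (w ≟ p)) {xs = neighbours x} w∈))

  -- the previous vertex p is a neighbour of x, so at most Δ − 1 steps remain
  length-forward : ∀ {p x} → Adjacent G p x → length (forward p x) ≤ Δ ∸ 1
  length-forward {p} {x} p~x = ≤-pred (≤-trans
    (filter-notAll (λ w → ¬? (w ≟ p)) (neighbours x)
      (Any.map (λ p≡w p≢w → p≢w (sym p≡w)) (∈-neighbours⁺ (adjacent-sym p~x))))
    (degree≤Δ x))
    where
    ≤-pred : ∀ {l} → suc l ≤ Δ → l ≤ Δ ∸ 1
    ≤-pred (s≤s l≤Δ-1) = l≤Δ-1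

  -- endpoints of non-backtracking walks of length 2 and 3 from u
  walks2 : Fin n → List (Fin n)
  walks2 u = concatMap (forward u) (neighbours u)

  walks3From : Fin n → Fin n → List (Fin n)
  walks3From u x = concatMap (forward x) (forward u x)

  walks3 : Fin n → List (Fin n)
  walks3 u = concatMap (walks3From u) (neighbours u)

  ball : Fin n → List (Fin n)
  ball u = neighbours u ++ (walks2 u ++ walks3 u)

  length-walks2 : ∀ u → length (walks2 u) ≤ Δ * (Δ ∸ 1)
  length-walks2 u = ≤-trans
    (length-concatMap-≤ (forward u) (neighbours u) (Δ ∸ 1)
      (λ x x∈ → length-forward (∈-neighbours⁻ x∈)))
    (*-mono-≤ (degree≤Δ u) ≤-refl)

  length-walks3 : ∀ u → length (walks3 u) ≤ Δ * ((Δ ∸ 1) * (Δ ∸ 1))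
  length-walks3 u = ≤-trans
    (length-concatMap-≤ (walks3From u) (neighbours u) _ length-walks3From)
    (*-mono-≤ (degree≤Δ u) ≤-refl)
    where
    length-walks3From : ∀ x → x ∈ neighbours u →
                        length (walks3From u x) ≤ (Δ ∸ 1) * (Δ ∸ 1)
    length-walks3From x x∈ = ≤-trans
      (length-concatMap-≤ (forward x) (forward u x) (Δ ∸ 1)
        (λ y y∈ → length-forward (∈-forward⁻ y∈)))
      (*-mono-≤ (length-forward (∈-neighbours⁻ x∈)) ≤-refl)

  length-ball : ∀ u → length (ball u) ≤ Δ + Δ * (Δ ∸ 1) + Δ * ((Δ ∸ 1) * (Δ ∸ 1))
  length-ball u = begin
    length (ball u)
      ≡⟨ length-++ (neighbours u) ⟩
    length (neighbours u) + length (walks2 u ++ walks3 u)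
      ≡⟨ cong (length (neighbours u) +_) (length-++ (walks2 u)) ⟩
    length (neighbours u) + (length (walks2 u) + length (walks3 u))
      ≤⟨ +-mono-≤ (degree≤Δ u) (+-mono-≤ (length-walks2 u) (length-walks3 u)) ⟩
    Δ + (Δ * (Δ ∸ 1) + Δ * ((Δ ∸ 1) * (Δ ∸ 1)))
      ≡⟨ +-assoc Δ _ _ ⟨
    Δ + Δ * (Δ ∸ 1) + Δ * ((Δ ∸ 1) * (Δ ∸ 1)) ∎
    where open ≤-Reasoning

  ∈-ball₁ : ∀ {a b} → Adjacent G a b → b ∈ ball a
  ∈-ball₁ a~b = ∈-++⁺ˡ (∈-neighbours⁺ a~b)

  ∈-ball₂ : ∀ {a x b} → Adjacent G a x → Adjacent G x b → b ≢ a → b ∈ ball a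
  ∈-ball₂ {a} a~x x~b b≢a = ∈-++⁺ʳ (neighbours a) (∈-++⁺ˡ
    (∈-concatMap⁺ (forward a) (lose (∈-neighbours⁺ a~x) (∈-forward⁺ x~b b≢a))))

  ∈-ball₃ : ∀ {a x y b} → Adjacent G a x → Adjacent G x y → Adjacent G y b →
            y ≢ a → b ≢ x → b ∈ ball a
  ∈-ball₃ {a} {x} a~x x~y y~b y≢a b≢x = ∈-++⁺ʳ (neighbours a) (∈-++⁺ʳ (walks2 a)
    (∈-concatMap⁺ (walks3From a) (lose (∈-neighbours⁺ a~x)
      (∈-concatMap⁺ (forward x) (lose (∈-forward⁺ x~y y≢a) (∈-forward⁺ y~b b≢x))))))

  -- every vertex b ≠ a that is 3-close to a lies in ball a: shorten the walk
  -- by its stationary steps and, where it backtracks, by the backtrack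
  close3⇒∈-ball : ∀ {a b} → a ≢ b → Close3 a b → b ∈ ball a
  close3⇒∈-ball a≢b (_ , _ , inj₁ refl , inj₁ refl , inj₁ refl) = ⊥-elim (a≢b refl)
  close3⇒∈-ball a≢b (_ , _ , inj₁ refl , inj₁ refl , inj₂ y~b) = ∈-ball₁ y~b
  close3⇒∈-ball a≢b (_ , _ , inj₁ refl , inj₂ x~y , inj₁ refl) = ∈-ball₁ x~y
  close3⇒∈-ball a≢b (_ , _ , inj₂ a~x , inj₁ refl , inj₁ refl) = ∈-ball₁ a~x
  close3⇒∈-ball a≢b (_ , _ , inj₁ refl , inj₂ x~y , inj₂ y~b) = ∈-ball₂ x~y y~b (λ e → a≢b (sym e))
  close3⇒∈-ball a≢b (_ , _ , inj₂ a~x , inj₁ refl , inj₂ y~b) = ∈-ball₂ a~x y~b (λ e → a≢b (sym e))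
  close3⇒∈-ball a≢b (_ , _ , inj₂ a~x , inj₂ x~y , inj₁ refl) = ∈-ball₂ a~x x~y (λ e → a≢b (sym e))
  close3⇒∈-ball {a} {b} a≢b (x , y , inj₂ a~x , inj₂ x~y , inj₂ y~b) with y ≟ a | b ≟ x
  ... | yes refl | _        = ∈-ball₁ y~b
  ... | no _     | yes refl = ∈-ball₁ a~x
  ... | no y≢a   | no b≢x   = ∈-ball₃ a~x x~y y~b y≢a b≢x

ball-size : ∀ Δ → Δ + Δ * (Δ ∸ 1) + Δ * ((Δ ∸ 1) * (Δ ∸ 1)) ≡ Δ * Δ * Δ ∸ Δ * Δ + Δ
ball-size zero = refl
ball-size (suc d) = begin
  suc d + suc d * d + suc d * (d * d)
    ≡⟨ rearrange d ⟩
  lower + suc d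
    ≡⟨ cong (_+ suc d) (m+n∸m≡n (suc d * suc d) lower) ⟨
  suc d * suc d + lower ∸ suc d * suc d + suc d
    ≡⟨ cong (λ t → t ∸ suc d * suc d + suc d) (cube d) ⟨
  suc d * suc d * suc d ∸ suc d * suc d + suc d ∎
  where
  open ≡-Reasoning
  -- (d + 1)³ − (d + 1)² = (d + 1)d + (d + 1)d²
  lower : ℕ
  lower = suc d * d + suc d * (d * d)
  cube : ∀ d → suc d * suc d * suc d ≡ suc d * suc d + (suc d * d + suc d * (d * d))
  cube = solve-∀
  rearrange : ∀ d → suc d + suc d * d + suc d * (d * d) ≡ suc d * d + suc d * (d * d) + suc d
  rearrange = solve-∀

mainTheorem7 : ∀ {n} (G : Graph n) (Δ : ℕ) → HasMaxDegree G Δ →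
    LidColorable G (Δ * Δ * Δ ∸ Δ * Δ + Δ + 1)
mainTheorem7 G Δ (degree≤Δ , _) =
  proj₁ colouring , separates-close3⇒lid (proj₁ colouring) (proj₂ colouring)
  where
  open Closeness G
  open BoundedDegree G Δ degree≤Δ
  ballShort : ∀ u → length (ball u) < Δ * Δ * Δ ∸ Δ * Δ + Δ + 1
  ballShort u = ≤-<-trans (subst (length (ball u) ≤_) (ball-size Δ) (length-ball u))
                          (m<m+n _ (s≤s z≤n))
  open GreedyColouring Close3 close3-sym ball close3⇒∈-ball ballShort
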